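{- Let $X$ be a finite set, let $\mathcal B$ and $\mathcal B^*$ be matroids on $X$, and let $B\mapsto B^*$ be a linking $\mathcal B\to\mathcal B^*$. Then the polynomial $$T_\omega(\mathcal B\to\mathcal B^*)(\mathbf x,\mathbf y)=\sum_{B\in\mathcal B}\mathbf x^{i_\omega(B)}\mathbf y^{i_\omega(B^*)}$$ does not depend on the choice of the linear order $\omega$ on $X$.
   Context: A pre-matroid on a finite set $X$ is a non-empty set $\mathcal B$ of subsets of $X$ (bases). For $Y\subseteq X$, $x\notin Y$ write $Y+x=Y\cup\{x\}$; for $y\in Y$ write $Y-y=Y\setminus\{y\}$. An almost-basis is a set $B-x$ with $B\in\mathcal B$, $x\in B$; for an almost-basis $D$ let $U(D)=\{x\in X\setminus D: D+x\in\mathcal B\}$. $\mathcal B$ is a matroid if for all $B_1,B_2\in\mathcal B$ and $x\in B_1\setminus B_2$ there is $y\in B_2\setminus B_1$ with $B_1-x+y\in\mathcal B$. A transposition of $X$ exchanges two distinct elements and fixes the others; permutations act on subsets elementwise. A bijection $\mathcal B\to\mathcal B^*$, $B\mapsto B^*$, is a linking if for every $B\in\mathcal B$ and every transposition $\tau$: (L1) if $\tau(B)\in\mathcal B$ then $\tau(B^*)\in\mathcal B^*$ and $\tau(B^*)=\tau(B)^*$; (L2) if $\tau(B^*)\in\mathcal B^*$ then $\tau(B)\in\mathcal B$ and $\tau(B^*)=\tau(B)^*$. For a linear order $\omega$ on $X$ and an almost-basis $D$, $\varphi_\omega(D)=D+\min_\omega U(D)$; for a basis $B$, $i_\omega(B)$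 is the number of almost-bases $D$ with $\varphi_\omega(D)=B$ (computed in $\mathcal B$ for $B\in\mathcal B$, and in $\mathcal B^*$ for $B^*\in\mathcal B^*$). $\mathbf x,\mathbf y$ are two independent variables. -}

module Defs where

open import Data.Nat using (ℕ; zero; suc; _+_; _≡ᵇ_)
open import Data.Bool using (Bool; true; false; T; not; _∧_; if_then_else_)
import Data.Bool as Bool
open import Data.Fin using (Fin)
open import Data.Fin.Subset using (Subset; _∈_; _∉_; _∪_; ⁅_⁆; _-_)
open import Data.Fin.Subset.Properties using (_∈?_)
open import Data.Fin.Permutation using (Permutation′; _⟨$⟩ʳ_; _⟨$⟩ˡ_; transpose)
open import Data.Vec using (Vec; []; _∷_; tabulate; lookup)
open import Data.Vec.Properties using (≡-dec)
open import Data.List using (List; []; _∷_; _++_; map; allFin)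
open import Data.Maybe using (Maybe; just; nothing)
open import Data.Product using (Σ; _×_; ∃; ∃-syntax)
open import Relation.Nullary using (¬_; isYes)
open import Relation.Binary.PropositionalEquality using (_≡_)

Family : ℕ → Set
Family n = Subset n → Bool

_∈𝓑_ : ∀ {n} → Subset n → Family n → Set
B ∈𝓑 𝓑 = T (𝓑 B)

_+ₛ_ : ∀ {n} → Subset n → Fin n → Subset n
Y +ₛ x = Y ∪ ⁅ x ⁆

IsPreMatroid : ∀ {n} → Family n → Set
IsPreMatroid 𝓑 = ∃[ B ] (B ∈𝓑 𝓑)

IsMatroid : ∀ {n} → Family n → Set
IsMatroid {n} 𝓑 =
  IsPreMatroid 𝓑 ×
  (∀ (B₁ B₂ : Subset n) → B₁ ∈𝓑 𝓑 → B₂ ∈𝓑 𝓑 → ∀ (x : Fin n) → x ∈ B₁ → x ∉ B₂ →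
     ∃[ y ] (y ∈ B₂ × y ∉ B₁ × (((B₁ - x) +ₛ y) ∈𝓑 𝓑)))

-- action of a permutation on subsets (elementwise image): w ∈ π(B) ⇔ π⁻¹ w ∈ B
act : ∀ {n} → Permutation′ n → Subset n → Subset n
act π B = tabulate (λ w → lookup B (π ⟨$⟩ˡ w))

-- A linking 𝓑 → 𝓑*, given by a map f on subsets whose restriction to 𝓑
-- is a bijection onto 𝓑*, satisfying (L1) and (L2) for all transpositions.
IsLinking : ∀ {n} → Family n → Family n → (Subset n → Subset n) → Set
IsLinking {n} 𝓑 𝓑* f =
  (∀ B → B ∈𝓑 𝓑 → f B ∈𝓑 𝓑*) ×
  (∀ B B′ → B ∈𝓑 𝓑 → B′ ∈𝓑 𝓑 → f B ≡ f B′ → B ≡ B′) ×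
  (∀ C → C ∈𝓑 𝓑* → ∃[ B ] (B ∈𝓑 𝓑 × f B ≡ C)) ×
  (∀ B → B ∈𝓑 𝓑 → ∀ (a b : Fin n) → ¬ a ≡ b →
     let τ = act (transpose a b) in
     (τ B ∈𝓑 𝓑 → (τ (f B) ∈𝓑 𝓑*) × (τ (f B) ≡ f (τ B))) ×
     (τ (f B) ∈𝓑 𝓑* → (τ B ∈𝓑 𝓑) × (τ (f B) ≡ f (τ B))))

allSubsets : (n : ℕ) → List (Subset n)
allSubsets zero = [] ∷ []
allSubsets (suc n) = map (false ∷_) (allSubsets n) ++ map (true ∷_) (allSubsets n)

count : ∀ {A : Set} → (A → Bool) → List A → ℕ
count p [] = 0
count p (a ∷ as) = (if p a then 1 else 0) + count p as

first : ∀ {A : Set} → (A → Bool) → List A → Maybe A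
first p [] = nothing
first p (a ∷ as) = if p a then just a else first p as

inU : ∀ {n} → Family n → Subset n → Fin n → Bool
inU 𝓑 D x = not (isYes (x ∈? D)) ∧ 𝓑 (D +ₛ x)

-- A linear order ω on Fin n is encoded by a permutation ω: x <_ω y iff
-- ω(x) < ω(y); so the ω-increasing enumeration of X is ω⁻¹(0), ω⁻¹(1), …
-- min_ω of a predicate (nothing if no element satisfies it):
minω : ∀ {n} → Permutation′ n → (Fin n → Bool) → Maybe (Fin n)
minω {n} ω P with first (λ k → P (ω ⟨$⟩ˡ k)) (allFin n)
... | nothing = nothing
... | just k = just (ω ⟨$⟩ˡ k)

-- φ_ω(D) = D + min_ω U(D); defined (just) exactly when U(D) ≠ ∅,
-- i.e. exactly when D is an almost-basis.
φ : ∀ {n} → Family n → Permutation′ n → Subset n → Maybe (Subset n)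
φ 𝓑 ω D with minω ω (inU 𝓑 D)
... | nothing = nothing
... | just x = just (D +ₛ x)

hits : ∀ {n} → Family n → Permutation′ n → Subset n → Subset n → Bool
hits 𝓑 ω B D with φ 𝓑 ω D
... | nothing = false
... | just B′ = isYes (≡-dec Bool._≟_ B′ B)

iω : ∀ {n} → Family n → Permutation′ n → Subset n → ℕ
iω {n} 𝓑 ω B = count (hits 𝓑 ω B) (allSubsets n)

-- The polynomial T_ω(𝓑 → 𝓑*)(x,y) = Σ_{B∈𝓑} x^{i_ω(B)} y^{i_ω(B*)},
-- represented by its coefficient function: the coefficient of x^a y^b.
Tω : ∀ {n} → Family n → Family n → (Subset n → Subset n) → Permutation′ n → ℕ → ℕ → ℕ
Tω {n} 𝓑 𝓑* f ω a b =
  count (λ B → 𝓑 B ∧ (iω 𝓑 ω B ≡ᵇ a) ∧ (iω 𝓑* ω (f B) ≡ᵇ b)) (allSubsets n)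

-- For B ∈ 𝓑 and y ∈ B the set U(B - y) is the fundamental cocircuit of y with respect to B, so
-- φ_ω(B - y) = B exactly when y is ω-least in it ("y is active"), and i_ω(B) counts the active
-- elements of B. By (L1) and (L2), B* has the same exchange graph in 𝓑* as B in 𝓑, so i_ω(B*)
-- counts the elements of B* that are active for B.
--
-- Any two orders are connected by swaps of adjacent elements e < g. Such a swap changes the active
-- set of B only if τ = (e g) maps B to a basis, e and g lie on different sides of B, and one of
-- them has no element of its fundamental set before it. On these bases the active sets of B before
-- and of τB after the swap correspond under τ, and τ(B*) = (τB)*. Hence B ↦ τB on them, and the
-- identity elsewhere, is an involution carrying each monomial of T before the swap to the same
-- monomial after it.

module Submission where

import Data.Bool as Bool
open import Data.Bool using (Bool; true; false; T; not; _∧_; _∨_; _xor_; if_then_else_)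
open import Data.Bool.Properties using (T-≡; ∨-zeroʳ; ∨-identityʳ; xor-same; xor-comm)
open import Data.Empty using (⊥-elim)
open import Data.Fin using (Fin; _≟_)
import Data.Fin.Permutation.Components as PC
open import Data.Fin.Permutation using (Permutation′; transpose; _⟨$⟩ˡ_; _⟨$⟩ʳ_; inverseˡ; inverseʳ)
open import Data.Fin.Subset using (Subset; _-_; ⁅_⁆)
import Data.Fin.Subset as S
open import Data.Fin.Subset.Properties using (_∈?_; x∈⁅x⁆; x∈⁅y⁆⇒x≡y; p─⊥≡p)
open import Data.List using (List; []; _∷_; _++_; map; allFin)
open import Data.List.Properties using (++-assoc)
open import Data.List.Membership.Propositional using (_∈_; _∉_)
open import Data.List.Membership.Propositional.Properties using (∈-map⁺; ∈-map⁻; ∈-++⁺ˡ; ∈-++⁺ʳ; ∈-allFin)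
open import Data.List.Membership.Propositional.Properties.WithK using (unique∧set⇒bag)
open import Data.List.Relation.Binary.BagAndSetEquality using (∼bag⇒↭)
open import Data.List.Relation.Binary.Disjoint.Propositional using (Disjoint)
open import Data.List.Relation.Binary.Permutation.Propositional as ↭ using (_↭_; ↭⇒↭ₛ)
open import Data.List.Relation.Binary.Permutation.Propositional.Properties using (++⁺ˡ)
open import Data.List.Relation.Unary.Any using (here; there)
open import Data.List.Relation.Unary.All using ([]; _∷_)
import Data.List.Relation.Unary.All as All
open import Data.List.Relation.Unary.AllPairs using ([]; _∷_)
open import Data.List.Relation.Unary.Unique.Propositional using (Unique)
import Data.List.Relation.Unary.Unique.Propositional.Properties as Unique
open import Data.Maybe using (just; nothing)
import Data.Maybe as Maybe using (map)
import Data.Maybe.Properties as Maybe using (≡-dec)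
open import Data.Nat using (ℕ; zero; suc; _+_; _≡ᵇ_)
open import Data.Product using (Σ; _×_; _,_; proj₁; proj₂)
open import Data.Sum using (_⊎_; inj₁; inj₂; [_,_]′)
open import Data.Vec using ([]; _∷_; lookup)
open import Data.Vec.Properties
  using (≡-dec; lookup∘tabulate; tabulate∘lookup; tabulate-cong; lookup-zipWith; []=⇒lookup; lookup⇒[]=)
open import Function.Base using (_∘_; id)
open import Function.Bundles using (mk⇔; Equivalence)
open import Relation.Nullary using (¬_; isYes; yes; no; Dec; does)
open import Relation.Nullary.Decidable using (dec-true; dec-false; _×-dec_; _⊎-dec_)
open import Relation.Binary.PropositionalEquality

open import Defs

private
  variable
    n : ℕ
    A A′ : Set

true≢false : true ≢ false
true≢false ()

contradictionᵇ : {b : Bool} → b ≡ true → b ≡ false → A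
contradictionᵇ p q = ⊥-elim (true≢false (trans (sym p) q))

T⇒≡true : {b : Bool} → T b → b ≡ true
T⇒≡true = Equivalence.to T-≡

≡true⇒T : {b : Bool} → b ≡ true → T b
≡true⇒T = Equivalence.from T-≡

≡⇒xor≡false : {a b : Bool} → a ≡ b → a xor b ≡ false
≡⇒xor≡false {a} refl = xor-same a

≢⇒xor≡true : {a b : Bool} → a ≢ b → a xor b ≡ true
≢⇒xor≡true {true}  {false} _ = refl
≢⇒xor≡true {false} {true}  _ = refl
≢⇒xor≡true {true}  {true}  a≢b = ⊥-elim (a≢b refl)
≢⇒xor≡true {false} {false} a≢b = ⊥-elim (a≢b refl)

xor-cong : {a b c d : Bool} → (a ≡ b → c ≡ d) → (c ≡ d → a ≡ b) → a xor b ≡ c xor d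
xor-cong {a} {b} to from with a Bool.≟ b
... | yes a≡b = trans (≡⇒xor≡false a≡b) (sym (≡⇒xor≡false (to a≡b)))
... | no a≢b  = trans (≢⇒xor≡true a≢b) (sym (≢⇒xor≡true (a≢b ∘ from)))

true-xor-false : {a b : Bool} → a ≡ true → b ≡ false → a xor b ≡ true
true-xor-false refl refl = refl

false-xor-true : {a b : Bool} → a ≡ false → b ≡ true → a xor b ≡ true
false-xor-true refl refl = refl

xor≡true-unique : {a b c : Bool} → a xor b ≡ true → a xor c ≡ true → b ≡ c
xor≡true-unique {true}  {false} {false} _ _ = refl
xor≡true-unique {false} {true}  {true}  _ _ = refl

xor≡true⇒≡not : {a b : Bool} → a xor b ≡ true → b ≡ not a
xor≡true⇒≡not {true}  {false} _ = refl
xor≡true⇒≡not {false} {true}  _ = refl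

xor≡true⇒≢ : {a b : Bool} → a xor b ≡ true → a ≢ b
xor≡true⇒≢ {a} h refl = true≢false (trans (sym h) (xor-same a))

true-or-false : (b : Bool) → b ≡ true ⊎ b ≡ false
true-or-false true  = inj₁ refl
true-or-false false = inj₂ refl

≡true⇔⇒≡ : {a b : Bool} → (a ≡ true → b ≡ true) → (b ≡ true → a ≡ true) → a ≡ b
≡true⇔⇒≡ {true}  {true}  f g = refl
≡true⇔⇒≡ {true}  {false} f g = sym (f refl)
≡true⇔⇒≡ {false} {true}  f g = g refl
≡true⇔⇒≡ {false} {false} f g = refl

count-cong : {p q : A → Bool} → (∀ a → p a ≡ q a) → ∀ xs → count p xs ≡ count q xs
count-cong e [] = refl
count-cong e (x ∷ xs) rewrite e x = cong (_ +_) (count-cong e xs)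

count-map : (p : A′ → Bool) (g : A → A′) (xs : List A) → count p (map g xs) ≡ count (p ∘ g) xs
count-map p g [] = refl
count-map p g (x ∷ xs) = cong (_ +_) (count-map p g xs)

count-↭ : (p : A → Bool) {xs ys : List A} → xs ↭ ys → count p xs ≡ count p ys
count-↭ p ↭.refl = refl
count-↭ p (↭.prep x r) = cong (_ +_) (count-↭ p r)
count-↭ p (↭.swap x y r) with p x | p y
... | true  | true  = cong (suc ∘ suc) (count-↭ p r)
... | true  | false = cong suc (count-↭ p r)
... | false | true  = cong suc (count-↭ p r)
... | false | false = count-↭ p r
count-↭ p (↭.trans r s) = trans (count-↭ p r) (count-↭ p s)

unique-↭ : {xs ys : List A} → xs ↭ ys → Unique xs → Unique ys
unique-↭ {A = A} r = Unique-resp-↭ (↭⇒↭ₛ r)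
  where open import Data.List.Relation.Binary.Permutation.Setoid.Properties (setoid A) using (Unique-resp-↭)

unique-complete⇒↭ : {xs ys : List A} → Unique xs → Unique ys →
  (∀ x → x ∈ xs) → (∀ x → x ∈ ys) → xs ↭ ys
unique-complete⇒↭ ux uy cx cy = ∼bag⇒↭ (unique∧set⇒bag ux uy (mk⇔ (λ _ → cy _) (λ _ → cx _)))

allSubsets-complete : ∀ n (S : Subset n) → S ∈ allSubsets n
allSubsets-complete zero [] = here refl
allSubsets-complete (suc n) (false ∷ S) = ∈-++⁺ˡ (∈-map⁺ (false ∷_) (allSubsets-complete n S))
allSubsets-complete (suc n) (true ∷ S) =
  ∈-++⁺ʳ (map (false ∷_) (allSubsets n)) (∈-map⁺ (true ∷_) (allSubsets-complete n S))

allSubsets-unique : ∀ n → Unique (allSubsets n)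
allSubsets-unique zero = [] ∷ []
allSubsets-unique (suc n) =
  Unique.++⁺ (Unique.map⁺ ∷-injectiveʳ (allSubsets-unique n)) (Unique.map⁺ ∷-injectiveʳ (allSubsets-unique n)) disjoint
  where
  ∷-injectiveʳ : ∀ {b} {S T : Subset n} → b ∷ S ≡ b ∷ T → S ≡ T
  ∷-injectiveʳ refl = refl
  disjoint : Disjoint (map (false ∷_) (allSubsets n)) (map (true ∷_) (allSubsets n))
  disjoint (i , j) with ∈-map⁻ (false ∷_) i | ∈-map⁻ (true ∷_) j
  ... | _ , _ , refl | _ , _ , ()

count-allSubsets-involution : (σ : Subset n → Subset n) → (∀ S → σ (σ S) ≡ S) → (p : Subset n → Bool) →
  count p (allSubsets n) ≡ count (p ∘ σ) (allSubsets n)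
count-allSubsets-involution {n} σ σσ p =
  trans (count-↭ p (unique-complete⇒↭ (allSubsets-unique n) (Unique.map⁺ σ-injective (allSubsets-unique n))
                      (allSubsets-complete n) σ-surjective))
        (count-map p σ (allSubsets n))
  where
  σ-injective : ∀ {S T} → σ S ≡ σ T → S ≡ T
  σ-injective {S} {T} e = trans (sym (σσ S)) (trans (cong σ e) (σσ T))
  σ-surjective : ∀ S → S ∈ map σ (allSubsets n)
  σ-surjective S = subst (_∈ map σ (allSubsets n)) (σσ S) (∈-map⁺ σ (allSubsets-complete n (σ S)))

module _ (P : A → Bool) where

  first-++-nothing : ∀ p q → first P p ≡ nothing → first P (p ++ q) ≡ first P q
  first-++-nothing [] q h = refl
  first-++-nothing (a ∷ p) q h with P a
  ... | false = first-++-nothing p q h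

  first-++-just : ∀ p q {y} → first P p ≡ just y → first P (p ++ q) ≡ just y
  first-++-just (a ∷ p) q h with P a
  ... | true  = h
  ... | false = first-++-just p q h

  first-satisfies : ∀ l {y} → first P l ≡ just y → P y ≡ true
  first-satisfies (a ∷ l) h with P a in Pa
  ... | true with refl ← h = Pa
  ... | false = first-satisfies l h

  first-∈ : ∀ l {y} → first P l ≡ just y → y ∈ l
  first-∈ (a ∷ l) h with P a
  ... | true with refl ← h = here refl
  ... | false = there (first-∈ l h)

  first-nothing⇒false : ∀ l {y} → first P l ≡ nothing → y ∈ l → P y ≡ false
  first-nothing⇒false (a ∷ l) h (here refl) with P a
  ... | false = refl
  first-nothing⇒false (a ∷ l) h (there y∈) with P a
  ... | false = first-nothing⇒false l h y∈

  first-∉-prefix : ∀ p r {y} → y ∉ p → first P (p ++ r) ≡ just y → first P p ≡ nothing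
  first-∉-prefix p r y∉p h with first P p in eq
  ... | nothing = refl
  ... | just z with refl ← trans (sym (first-++-just p r eq)) h = ⊥-elim (y∉p (first-∈ p eq))

  first-after-prefix : ∀ p a r → P a ≡ true → first P p ≡ nothing → first P (p ++ a ∷ r) ≡ just a
  first-after-prefix p a r Pa h rewrite first-++-nothing p (a ∷ r) h | Pa = refl

  first-skip : ∀ p a b r → P b ≡ false → P a ≡ true → first P p ≡ nothing → first P (p ++ b ∷ a ∷ r) ≡ just a
  first-skip p a b r Pb Pa h rewrite first-++-nothing p (b ∷ a ∷ r) h | Pb | Pa = refl

  first-blocked : ∀ p a b r → b ∉ p → a ≢ b → P a ≡ true → first P (p ++ a ∷ b ∷ r) ≢ just b
  first-blocked p a b r b∉p a≢b Pa h
    with refl ← trans (sym (first-after-prefix p a (b ∷ r) Pa (first-∉-prefix p (a ∷ b ∷ r) b∉p h))) h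
    = a≢b refl

  first-swap-other : ∀ p a b s {x} → x ≢ a → x ≢ b →
    first P (p ++ a ∷ b ∷ s) ≡ just x → first P (p ++ b ∷ a ∷ s) ≡ just x
  first-swap-other p a b s x≢a x≢b h with first P p in eq
  ... | just y = trans (first-++-just p (b ∷ a ∷ s) eq) (trans (sym (first-++-just p (a ∷ b ∷ s) eq)) h)
  ... | nothing rewrite first-++-nothing p (a ∷ b ∷ s) eq | first-++-nothing p (b ∷ a ∷ s) eq with P a | P b
  ...   | true  | _     with refl ← h = ⊥-elim (x≢a refl)
  ...   | false | true  with refl ← h = ⊥-elim (x≢b refl)
  ...   | false | false = h

  first-in-prefix : ∀ p a b s {x} → (P a ≡ true ⊎ P b ≡ true) → x ≢ a → x ≢ b →
    first P (p ++ a ∷ b ∷ s) ≡ just x → first P p ≡ just x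
  first-in-prefix p a b s Pab x≢a x≢b h with first P p in eq
  ... | just y = trans (sym (first-++-just p (a ∷ b ∷ s) eq)) h
  ... | nothing rewrite first-++-nothing p (a ∷ b ∷ s) eq with P a | P b | Pab
  ...   | true  | _     | _ with refl ← h = ⊥-elim (x≢a refl)
  ...   | false | true  | _ with refl ← h = ⊥-elim (x≢b refl)
  ...   | false | false | inj₁ ()
  ...   | false | false | inj₂ ()

first-cong : {P Q : A → Bool} → (∀ y → P y ≡ Q y) → ∀ l → first P l ≡ first Q l
first-cong e [] = refl
first-cong {Q = Q} e (a ∷ l) rewrite e a with Q a
... | true  = refl
... | false = first-cong e l

first-⊆ : (P Q : A → Bool) → ∀ l {x} → (∀ y → y ∈ l → Q y ≡ true → P y ≡ true) →
  first P l ≡ just x → Q x ≡ true → first Q l ≡ just x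
first-⊆ P Q (a ∷ l) Q⊆P h Qx with P a in Pa | Q a in Qa
... | true  | true  = h
... | true  | false with refl ← h = contradictionᵇ Qx Qa
... | false | true  = contradictionᵇ (Q⊆P a (here refl) Qa) Pa
... | false | false = first-⊆ P Q l (λ y y∈ → Q⊆P y (there y∈)) h Qx

∈⇒lookup : {x : Fin n} {S : Subset n} → x S.∈ S → lookup S x ≡ true
∈⇒lookup = []=⇒lookup

lookup⇒∈ : {x : Fin n} {S : Subset n} → lookup S x ≡ true → x S.∈ S
lookup⇒∈ {x = x} {S} = lookup⇒[]= x S

∉⇒lookup : {x : Fin n} {S : Subset n} → x S.∉ S → lookup S x ≡ false
∉⇒lookup {x = x} {S} x∉S with lookup S x in eq
... | true  = ⊥-elim (x∉S (lookup⇒∈ eq))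
... | false = refl

isYes-∈? : (x : Fin n) (S : Subset n) → isYes (x ∈? S) ≡ lookup S x
isYes-∈? x S with x ∈? S
... | yes x∈S = sym (∈⇒lookup x∈S)
... | no x∉S  = sym (∉⇒lookup x∉S)

subset-ext : {S T : Subset n} → (∀ w → lookup S w ≡ lookup T w) → S ≡ T
subset-ext {S = S} {T} h = trans (sym (tabulate∘lookup S)) (trans (tabulate-cong h) (tabulate∘lookup T))

lookup-⁅x⁆-other : (x w : Fin n) → w ≢ x → lookup ⁅ x ⁆ w ≡ false
lookup-⁅x⁆-other x w w≢x = ∉⇒lookup (w≢x ∘ x∈⁅y⁆⇒x≡y x)

lookup-minus-self : (S : Subset n) (x : Fin n) → lookup (S - x) x ≡ false
lookup-minus-self (_ ∷ S) Fin.zero    = refl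
lookup-minus-self (_ ∷ S) (Fin.suc x) = lookup-minus-self S x

lookup-minus-other : (S : Subset n) (x w : Fin n) → w ≢ x → lookup (S - x) w ≡ lookup S w
lookup-minus-other (_ ∷ S) Fin.zero    Fin.zero    w≢x = ⊥-elim (w≢x refl)
lookup-minus-other (_ ∷ S) Fin.zero    (Fin.suc w) w≢x = cong (λ T → lookup T w) (p─⊥≡p S)
lookup-minus-other (_ ∷ S) (Fin.suc x) Fin.zero    w≢x = refl
lookup-minus-other (_ ∷ S) (Fin.suc x) (Fin.suc w) w≢x = lookup-minus-other S x w (w≢x ∘ cong Fin.suc)

lookup-plus-self : (S : Subset n) (x : Fin n) → lookup (S +ₛ x) x ≡ true
lookup-plus-self S x rewrite lookup-zipWith _∨_ x S ⁅ x ⁆ | ∈⇒lookup (x∈⁅x⁆ x) = ∨-zeroʳ _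

lookup-plus-other : (S : Subset n) (x w : Fin n) → w ≢ x → lookup (S +ₛ x) w ≡ lookup S w
lookup-plus-other S x w w≢x rewrite lookup-zipWith _∨_ w S ⁅ x ⁆ | lookup-⁅x⁆-other x w w≢x = ∨-identityʳ _

-- act π reads a subset through π⁻¹, and transpose a b ⟨$⟩ˡ_ is PC.transpose b a.
τᵉ : Fin n → Fin n → Fin n → Fin n
τᵉ a b = PC.transpose b a

τ : Fin n → Fin n → Subset n → Subset n
τ a b = act (transpose a b)

module _ {n : ℕ} where

  τᵉ-a : (a b : Fin n) → τᵉ a b a ≡ b
  τᵉ-a a b with a ≟ b
  ... | yes refl = refl
  ... | no _ rewrite dec-true (a ≟ a) refl = refl

  τᵉ-b : (a b : Fin n) → τᵉ a b b ≡ a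
  τᵉ-b a b rewrite dec-true (b ≟ b) refl = refl

  τᵉ-other : (a b w : Fin n) → w ≢ a → w ≢ b → τᵉ a b w ≡ w
  τᵉ-other a b w w≢a w≢b rewrite dec-false (w ≟ b) w≢b | dec-false (w ≟ a) w≢a = refl

  τᵉ-sym : (a b w : Fin n) → τᵉ a b w ≡ τᵉ b a w
  τᵉ-sym a b w = by-cases (w ≟ a) (w ≟ b)
    where
    by-cases : Dec (w ≡ a) → Dec (w ≡ b) → τᵉ a b w ≡ τᵉ b a w
    by-cases (yes refl) _          = trans (τᵉ-a a b) (sym (τᵉ-b b a))
    by-cases (no _)     (yes refl) = trans (τᵉ-b a b) (sym (τᵉ-a b a))
    by-cases (no w≢a)   (no w≢b)   = trans (τᵉ-other a b w w≢a w≢b) (sym (τᵉ-other b a w w≢b w≢a))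

  τᵉ-involutive : (a b w : Fin n) → τᵉ a b (τᵉ a b w) ≡ w
  τᵉ-involutive a b w = trans (cong (τᵉ a b) (τᵉ-sym a b w)) (PC.transpose-inverse b a)

  lookup-τ : (a b : Fin n) (S : Subset n) (w : Fin n) → lookup (τ a b S) w ≡ lookup S (τᵉ a b w)
  lookup-τ a b S w = lookup∘tabulate _ w

  lookup-τ-a : (a b : Fin n) (S : Subset n) → lookup (τ a b S) a ≡ lookup S b
  lookup-τ-a a b S = trans (lookup-τ a b S a) (cong (lookup S) (τᵉ-a a b))

  lookup-τ-b : (a b : Fin n) (S : Subset n) → lookup (τ a b S) b ≡ lookup S a
  lookup-τ-b a b S = trans (lookup-τ a b S b) (cong (lookup S) (τᵉ-b a b))

  lookup-τ-other : (a b : Fin n) (S : Subset n) (w : Fin n) → w ≢ a → w ≢ b → lookup (τ a b S) w ≡ lookup S w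
  lookup-τ-other a b S w w≢a w≢b = trans (lookup-τ a b S w) (cong (lookup S) (τᵉ-other a b w w≢a w≢b))

  τ-involutive : (a b : Fin n) (S : Subset n) → τ a b (τ a b S) ≡ S
  τ-involutive a b S = subset-ext λ w →
    trans (lookup-τ a b (τ a b S) w) (trans (lookup-τ a b S (τᵉ a b w)) (cong (lookup S) (τᵉ-involutive a b w)))

  τ-sym : (a b : Fin n) (S : Subset n) → τ a b S ≡ τ b a S
  τ-sym a b S = subset-ext λ w →
    trans (lookup-τ a b S w) (trans (cong (lookup S) (τᵉ-sym a b w)) (sym (lookup-τ b a S w)))

  τ-same-side : (a b : Fin n) (S : Subset n) → lookup S a ≡ lookup S b → τ a b S ≡ S
  τ-same-side a b S Sa≡Sb = subset-ext pointwise
    where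
    pointwise : ∀ w → lookup (τ a b S) w ≡ lookup S w
    pointwise w with w ≟ a | w ≟ b
    ... | yes refl | _        = trans (lookup-τ-a w b S) (sym Sa≡Sb)
    ... | no _     | yes refl = trans (lookup-τ-b a w S) Sa≡Sb
    ... | no w≢a   | no w≢b   = lookup-τ-other a b S w w≢a w≢b

  -- (a b)(b c) = (a c)(a b), and (a b) fixes S when a, b are on the same side of S.
  τ-merge : (a b c : Fin n) (S : Subset n) → a ≢ b → b ≢ c → a ≢ c → lookup S a ≡ lookup S b →
    τ a b (τ b c S) ≡ τ a c S
  τ-merge a b c S a≢b b≢c a≢c Sa≡Sb = subset-ext pointwise
    where
    pointwise : ∀ w → lookup (τ a b (τ b c S)) w ≡ lookup (τ a c S) w
    pointwise w with w ≟ a | w ≟ b | w ≟ c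
    ... | yes refl | _ | _ = trans (lookup-τ-a w b (τ b c S)) (trans (lookup-τ-a b c S) (sym (lookup-τ-a w c S)))
    ... | no w≢a | yes refl | _ =
      trans (lookup-τ-b a w (τ w c S)) (trans (lookup-τ-other w c S a a≢b a≢c)
        (trans Sa≡Sb (sym (lookup-τ-other a c S w (a≢b ∘ sym) b≢c))))
    ... | no w≢a | no w≢b | yes refl =
      trans (lookup-τ-other a b (τ b w S) w w≢a w≢b) (trans (lookup-τ-b b w S) (trans (sym Sa≡Sb) (sym (lookup-τ-b a w S))))
    ... | no w≢a | no w≢b | no w≢c =
      trans (lookup-τ-other a b (τ b c S) w w≢a w≢b)
        (trans (lookup-τ-other b c S w w≢b w≢c) (sym (lookup-τ-other a c S w w≢a w≢c)))

  τ-comm : (a b c d : Fin n) (S : Subset n) → a ≢ c → a ≢ d → b ≢ c → b ≢ d → τ a b (τ c d S) ≡ τ c d (τ a b S)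
  τ-comm a b c d S a≢c a≢d b≢c b≢d = subset-ext λ w →
    trans (lookup-τ a b (τ c d S) w) (trans (lookup-τ c d S (τᵉ a b w))
      (trans (cong (lookup S) (τᵉ-commute w)) (sym (trans (lookup-τ c d (τ a b S) w) (lookup-τ a b S (τᵉ c d w))))))
    where
    τᵉ-commute : ∀ w → τᵉ c d (τᵉ a b w) ≡ τᵉ a b (τᵉ c d w)
    τᵉ-commute w = by-cases (w ≟ a) (w ≟ b) (w ≟ c) (w ≟ d)
      where
      by-cases : Dec (w ≡ a) → Dec (w ≡ b) → Dec (w ≡ c) → Dec (w ≡ d) → τᵉ c d (τᵉ a b w) ≡ τᵉ a b (τᵉ c d w)
      by-cases (yes refl) _ _ _ rewrite τᵉ-a a b | τᵉ-other c d b b≢c b≢d | τᵉ-other c d a a≢c a≢d | τᵉ-a a b = refl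
      by-cases (no _) (yes refl) _ _ rewrite τᵉ-b a b | τᵉ-other c d a a≢c a≢d | τᵉ-other c d b b≢c b≢d | τᵉ-b a b = refl
      by-cases (no w≢a) (no w≢b) (yes refl) _
        rewrite τᵉ-other a b c w≢a w≢b | τᵉ-a c d | τᵉ-other a b d (a≢d ∘ sym) (b≢d ∘ sym) = refl
      by-cases (no w≢a) (no w≢b) (no _) (yes refl)
        rewrite τᵉ-other a b d w≢a w≢b | τᵉ-b c d | τᵉ-other a b c (a≢c ∘ sym) (b≢c ∘ sym) = refl
      by-cases (no w≢a) (no w≢b) (no w≢c) (no w≢d)
        rewrite τᵉ-other a b w w≢a w≢b | τᵉ-other c d w w≢c w≢d | τᵉ-other a b w w≢a w≢b = refl

  τ-minus : (a b : Fin n) (S : Subset n) (y : Fin n) → τ a b (S - y) ≡ τ a b S - τᵉ a b y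
  τ-minus a b S y = subset-ext pointwise
    where
    pointwise : ∀ w → lookup (τ a b (S - y)) w ≡ lookup (τ a b S - τᵉ a b y) w
    pointwise w with w ≟ τᵉ a b y
    ... | yes refl = trans (lookup-τ a b (S - y) w)
                       (trans (cong (lookup (S - y)) (τᵉ-involutive a b y))
                         (trans (lookup-minus-self S y) (sym (lookup-minus-self (τ a b S) w))))
    ... | no w≢τy = trans (lookup-τ a b (S - y) w)
                      (trans (lookup-minus-other S y (τᵉ a b w)
                               (λ e → w≢τy (trans (sym (τᵉ-involutive a b w)) (cong (τᵉ a b) e))))
                        (sym (trans (lookup-minus-other (τ a b S) (τᵉ a b y) w w≢τy) (lookup-τ a b S w))))

  exchange≡τ : (S : Subset n) (x y : Fin n) → lookup S x ≡ true → lookup S y ≡ false → (S - x) +ₛ y ≡ τ x y S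
  exchange≡τ S x y Sx Sy = subset-ext pointwise
    where
    pointwise : ∀ w → lookup ((S - x) +ₛ y) w ≡ lookup (τ x y S) w
    pointwise w with w ≟ y | w ≟ x
    ... | yes refl | _ = trans (lookup-plus-self (S - x) w) (sym (trans (lookup-τ-b x w S) Sx))
    ... | no w≢y | yes refl =
      trans (lookup-plus-other (S - w) y w w≢y) (trans (lookup-minus-self S w) (sym (trans (lookup-τ-a w y S) Sy)))
    ... | no w≢y | no w≢x =
      trans (lookup-plus-other (S - x) y w w≢y) (trans (lookup-minus-other S x w w≢x) (sym (lookup-τ-other x y S w w≢x w≢y)))

  minus-plus : (S : Subset n) (x : Fin n) → lookup S x ≡ true → (S - x) +ₛ x ≡ S
  minus-plus S x Sx = subset-ext pointwise
    where
    pointwise : ∀ w → lookup ((S - x) +ₛ x) w ≡ lookup S w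
    pointwise w with w ≟ x
    ... | yes refl = trans (lookup-plus-self (S - w) w) (sym Sx)
    ... | no w≢x = trans (lookup-plus-other (S - x) x w w≢x) (lookup-minus-other S x w w≢x)

  plus⇒minus : (D S : Subset n) (y : Fin n) → lookup D y ≡ false → D +ₛ y ≡ S → D ≡ S - y
  plus⇒minus D S y Dy refl = subset-ext pointwise
    where
    pointwise : ∀ w → lookup D w ≡ lookup ((D +ₛ y) - y) w
    pointwise w with w ≟ y
    ... | yes refl = trans Dy (sym (lookup-minus-self (D +ₛ w) w))
    ... | no w≢y = sym (trans (lookup-minus-other (D +ₛ y) y w w≢y) (lookup-plus-other D y w w≢y))

  inside-outside⇒≢ : (S : Subset n) {a b : Fin n} → lookup S a ≡ true → lookup S b ≡ false → a ≢ b
  inside-outside⇒≢ S Sa Sb refl = true≢false (trans (sym Sa) Sb)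

  τ-cancel-commuting : (u v x y : Fin n) (S : Subset n) → x ≢ u → x ≢ v → y ≢ u → y ≢ v →
    τ v u (τ x y (τ u v S)) ≡ τ x y S
  τ-cancel-commuting u v x y S x≢u x≢v y≢u y≢v = begin
    τ v u (τ x y (τ u v S)) ≡⟨ cong (τ v u) (τ-comm x y u v S x≢u x≢v y≢u y≢v) ⟩
    τ v u (τ u v (τ x y S)) ≡⟨ τ-sym v u (τ u v (τ x y S)) ⟩
    τ u v (τ u v (τ x y S)) ≡⟨ τ-involutive u v (τ x y S) ⟩
    τ x y S                 ∎
    where open ≡-Reasoning

  τ-collapse : (u v a y : Fin n) (S : Subset n) → a ≢ u → a ≢ v → a ≢ y → u ≢ v → y ≢ u → y ≢ v →
    lookup S u ≡ lookup S a → lookup S y ≡ lookup S v → τ v a (τ a y (τ u v S)) ≡ τ u y S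
  τ-collapse u v a y S a≢u a≢v a≢y u≢v y≢u y≢v Su≡Sa Sy≡Sv = begin
    τ v a (τ a y (τ u v S)) ≡⟨ τ-merge v a y (τ u v S) (a≢v ∘ sym) a≢y (y≢v ∘ sym)
                                  (trans (lookup-τ-b u v S) (trans Su≡Sa (sym (lookup-τ-other u v S a a≢u a≢v)))) ⟩
    τ v y (τ u v S)         ≡⟨ τ-sym v y (τ u v S) ⟩
    τ y v (τ u v S)         ≡⟨ cong (τ y v) (τ-sym u v S) ⟩
    τ y v (τ v u S)         ≡⟨ τ-merge y v u S y≢v (u≢v ∘ sym) y≢u Sy≡Sv ⟩
    τ y u S                 ≡⟨ τ-sym y u S ⟩
    τ u y S                 ∎
    where open ≡-Reasoning

-- Fundamental circuits and cocircuits

-- For a basis B this is the fundamental cocircuit of x ∈ B, resp. the fundamental circuit of x ∉ B;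
-- for B ∈ 𝓑 and x ∈ B it is U(B - x).
fundamental : Family n → Subset n → Fin n → Fin n → Bool
fundamental 𝓑 B x z = isYes (x ≟ z) ∨ ((lookup B x xor lookup B z) ∧ 𝓑 (τ x z B))

Active : Family n → List (Fin n) → Subset n → Fin n → Set
Active 𝓑 L B x = first (fundamental 𝓑 B x) L ≡ just x

module _ (𝓑 : Family n) where

  private
    C = fundamental 𝓑

  fundamental-self : (B : Subset n) (x : Fin n) → C B x x ≡ true
  fundamental-self B x with x ≟ x
  ... | yes _   = refl
  ... | no x≢x = ⊥-elim (x≢x refl)

  fundamental-other : (B : Subset n) (x z : Fin n) → z ≢ x → C B x z ≡ (lookup B x xor lookup B z) ∧ 𝓑 (τ x z B)
  fundamental-other B x z z≢x with x ≟ z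
  ... | yes x≡z = ⊥-elim (z≢x (sym x≡z))
  ... | no _    = refl

  fundamental-intro : (B : Subset n) (x z : Fin n) → (lookup B x xor lookup B z) ≡ true → 𝓑 (τ x z B) ≡ true →
    C B x z ≡ true
  fundamental-intro B x z sides basis with x ≟ z
  ... | yes _ = refl
  ... | no _ rewrite sides | basis = refl

  fundamental-elim : (B : Subset n) (x z : Fin n) → z ≢ x → C B x z ≡ true →
    (lookup B x xor lookup B z) ≡ true × 𝓑 (τ x z B) ≡ true
  fundamental-elim B x z z≢x h = ∧-true (trans (sym (fundamental-other B x z z≢x)) h)
    where
    ∧-true : {a b : Bool} → a ∧ b ≡ true → a ≡ true × b ≡ true
    ∧-true {true} h = refl , h

  fundamental-τ : (B : Subset n) (a b : Fin n) → 𝓑 B ≡ true → 𝓑 (τ a b B) ≡ true →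
    (lookup B a xor lookup B b) ≡ true → ∀ z → C (τ a b B) b z ≡ C B a z
  fundamental-τ B a b basis basis′ sides z = by-cases (z ≟ b) (z ≟ a)
    where
    a≢b = xor≡true⇒≢ sides ∘ cong (lookup B)
    by-cases : Dec (z ≡ b) → Dec (z ≡ a) → C (τ a b B) b z ≡ C B a z
    by-cases (yes refl) _ = trans (fundamental-self (τ a z B) z) (sym (fundamental-intro B a z sides basis′))
    by-cases (no _) (yes refl) =
      trans (fundamental-intro (τ z b B) b z (trans (cong₂ _xor_ (lookup-τ-b z b B) (lookup-τ-a z b B)) sides)
               (trans (cong 𝓑 (trans (τ-sym b z (τ z b B)) (τ-involutive z b B))) basis))
            (sym (fundamental-self B z))
    by-cases (no z≢b) (no z≢a)
      rewrite fundamental-other (τ a b B) b z z≢b | fundamental-other B a z z≢a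
            | lookup-τ-b a b B | lookup-τ-other a b B z z≢a z≢b
      with lookup B a xor lookup B z in sides′
    ... | false = refl
    ... | true = cong 𝓑 (begin
          τ b z (τ a b B) ≡⟨ τ-sym b z (τ a b B) ⟩
          τ z b (τ a b B) ≡⟨ cong (τ z b) (τ-sym a b B) ⟩
          τ z b (τ b a B) ≡⟨ τ-merge z b a B z≢b (a≢b ∘ sym) z≢a (xor≡true-unique {lookup B a} sides′ sides) ⟩
          τ z a B         ≡⟨ τ-sym z a B ⟩
          τ a z B         ∎)
      where
      open ≡-Reasoning

BasisExchange : Family n → Set
BasisExchange {n} 𝓑 =
  ∀ (B₁ B₂ : Subset n) → B₁ ∈𝓑 𝓑 → B₂ ∈𝓑 𝓑 → ∀ (x : Fin n) → x S.∈ B₁ → x S.∉ B₂ →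
    Σ (Fin n) λ y → y S.∈ B₂ × y S.∉ B₁ × (((B₁ - x) +ₛ y) ∈𝓑 𝓑)

record IsExchange (𝓑 : Family n) (B : Subset n) (u v : Fin n) : Set where
  field
    basis  : 𝓑 B ≡ true
    basis′ : 𝓑 (τ u v B) ≡ true
    u∈B    : lookup B u ≡ true
    v∉B    : lookup B v ≡ false

module Matroid {n : ℕ} {𝓑 : Family n} (exchange : BasisExchange 𝓑) where

  private
    C = fundamental 𝓑

  exchange-τ : (B₁ B₂ : Subset n) (x : Fin n) → 𝓑 B₁ ≡ true → 𝓑 B₂ ≡ true →
    lookup B₁ x ≡ true → lookup B₂ x ≡ false →
    Σ (Fin n) λ z → lookup B₂ z ≡ true × lookup B₁ z ≡ false × 𝓑 (τ x z B₁) ≡ true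
  exchange-τ B₁ B₂ x B₁∈𝓑 B₂∈𝓑 x∈B₁ x∉B₂
    with z , z∈B₂ , z∉B₁ , exchanged ← exchange B₁ B₂ (≡true⇒T B₁∈𝓑) (≡true⇒T B₂∈𝓑)
                                          x (lookup⇒∈ x∈B₁) (λ x∈ → true≢false (trans (sym (∈⇒lookup x∈)) x∉B₂))
    = z , ∈⇒lookup z∈B₂ , ∉⇒lookup z∉B₁
      , trans (cong 𝓑 (sym (exchange≡τ B₁ x z x∈B₁ (∉⇒lookup z∉B₁)))) (T⇒≡true exchanged)

  module _ {B : Subset n} {u v : Fin n} (E : IsExchange 𝓑 B u v) where

    open IsExchange E

    private
      B′ = τ u v B
      u≢v = inside-outside⇒≢ B u∈B v∉B

      lookup-B′ : ∀ w → w ≢ u → w ≢ v → lookup B′ w ≡ lookup B w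
      lookup-B′ = lookup-τ-other u v B

    exchange-stable-inside : ∀ x y → lookup B x ≡ true → lookup B y ≡ false → x ≢ u → y ≢ u → y ≢ v →
      𝓑 (τ x v B) ≡ false → 𝓑 (τ x y B) ≡ 𝓑 (τ x y B′)
    exchange-stable-inside x y x∈B y∉B x≢u y≢u y≢v x↮v = ≡true⇔⇒≡ to from
      where
      x≢v = inside-outside⇒≢ B x∈B v∉B
      x≢y = inside-outside⇒≢ B x∈B y∉B
      to : 𝓑 (τ x y B) ≡ true → 𝓑 (τ x y B′) ≡ true
      to h with exchange-τ B′ (τ x y B) x basis′ h (trans (lookup-B′ x x≢u x≢v) x∈B) (trans (lookup-τ-a x y B) y∉B)
      ... | z , z∈ , z∉ , h′ with z ≟ u | z ≟ y | z ≟ x | z ≟ v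
      ... | yes refl | _ | _ | _ =
        contradictionᵇ (trans (cong 𝓑 (sym (τ-merge x u v B x≢u u≢v x≢v (trans x∈B (sym u∈B))))) h′) x↮v
      ... | no _ | yes refl | _ | _ = h′
      ... | no _ | no _ | yes refl | _ = contradictionᵇ z∈ (trans (lookup-τ-a x y B) y∉B)
      ... | no _ | no _ | no _ | yes refl = contradictionᵇ z∈ (trans (lookup-τ-other x y B z (x≢v ∘ sym) (y≢v ∘ sym)) v∉B)
      ... | no z≢u | no z≢y | no z≢x | no z≢v =
        contradictionᵇ (trans (sym (lookup-τ-other x y B z z≢x z≢y)) z∈) (trans (sym (lookup-B′ z z≢u z≢v)) z∉)
      from : 𝓑 (τ x y B′) ≡ true → 𝓑 (τ x y B) ≡ true
      from h with exchange-τ B (τ x y B′) x basis h x∈B (trans (lookup-τ-a x y B′) (trans (lookup-B′ y y≢u y≢v) y∉B))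
      ... | z , z∈ , z∉ , h′ with z ≟ v | z ≟ y | z ≟ x | z ≟ u
      ... | yes refl | _ | _ | _ = contradictionᵇ h′ x↮v
      ... | no _ | yes refl | _ | _ = h′
      ... | no _ | no _ | yes refl | _ = contradictionᵇ x∈B z∉
      ... | no _ | no _ | no _ | yes refl = contradictionᵇ u∈B z∉
      ... | no z≢v | no z≢y | no z≢x | no z≢u =
        contradictionᵇ (trans (sym (trans (lookup-τ-other x y B′ z z≢x z≢y) (lookup-B′ z z≢u z≢v))) z∈) z∉

    exchange-stable-outside : ∀ x y → lookup B x ≡ false → lookup B y ≡ true → x ≢ v → y ≢ u → y ≢ v →
      𝓑 (τ u x B) ≡ false → 𝓑 (τ x y B) ≡ 𝓑 (τ x y B′)
    exchange-stable-outside x y x∉B y∈B x≢v y≢u y≢v u↮x = ≡true⇔⇒≡ to from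
      where
      x≢u = inside-outside⇒≢ B u∈B x∉B ∘ sym
      y≢x = inside-outside⇒≢ B y∈B x∉B
      to : 𝓑 (τ x y B) ≡ true → 𝓑 (τ x y B′) ≡ true
      to h with exchange-τ (τ x y B) B′ u h basis′ (trans (lookup-τ-other x y B u (x≢u ∘ sym) (y≢u ∘ sym)) u∈B)
                  (trans (lookup-τ-a u v B) v∉B)
      ... | z , z∈ , z∉ , h′ with z ≟ y | z ≟ v | z ≟ x | z ≟ u
      ... | yes refl | _ | _ | _ =
        contradictionᵇ (trans (cong 𝓑 (sym (trans (cong (τ u z) (τ-sym x z B))
                                                   (τ-merge u z x B (y≢u ∘ sym) y≢x (x≢u ∘ sym) (trans u∈B (sym y∈B)))))) h′)
                       u↮x
      ... | no _ | yes refl | _ | _ = trans (cong 𝓑 (τ-comm x y u z B x≢u x≢v y≢u y≢v)) h′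
      ... | no _ | no _ | yes refl | _ = contradictionᵇ z∈ (trans (lookup-B′ z x≢u x≢v) x∉B)
      ... | no _ | no _ | no _ | yes refl = contradictionᵇ z∈ (trans (lookup-τ-a z v B) v∉B)
      ... | no z≢y | no z≢v | no z≢x | no z≢u =
        contradictionᵇ (trans (sym (lookup-B′ z z≢u z≢v)) z∈) (trans (sym (lookup-τ-other x y B z z≢x z≢y)) z∉)
      from : 𝓑 (τ x y B′) ≡ true → 𝓑 (τ x y B) ≡ true
      from h with exchange-τ (τ x y B′) B v h basis (trans (lookup-τ-other x y B′ v (x≢v ∘ sym) (y≢v ∘ sym))
                                                     (trans (lookup-τ-b u v B) u∈B)) v∉B
      ... | z , z∈ , z∉ , h′ with z ≟ y | z ≟ u | z ≟ x | z ≟ v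
      ... | yes refl | _ | _ | _ =
        contradictionᵇ (trans (cong 𝓑 (sym (trans (cong (τ v z) (τ-sym x z B′))
                                                   (τ-collapse u v z x B y≢u y≢v y≢x u≢v x≢u x≢v
                                                     (trans u∈B (sym y∈B)) (trans x∉B (sym v∉B))))))
                              h′)
                       u↮x
      ... | no _ | yes refl | _ | _ = trans (cong 𝓑 (sym (τ-cancel-commuting z v x y B x≢u x≢v y≢u y≢v))) h′
      ... | no _ | no _ | yes refl | _ = contradictionᵇ z∈ x∉B
      ... | no _ | no _ | no _ | yes refl = contradictionᵇ z∈ v∉B
      ... | no z≢y | no z≢u | no z≢x | no z≢v =
        contradictionᵇ z∈ (trans (sym (trans (lookup-τ-other x y B′ z z≢x z≢y) (lookup-B′ z z≢u z≢v))) z∉)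

    fundamental-stable-inside : ∀ x → lookup B x ≡ true → x ≢ u → 𝓑 (τ x v B) ≡ false → ∀ y → C B x y ≡ C B′ x y
    fundamental-stable-inside x x∈B x≢u x↮v = pointwise
      where
      x≢v = inside-outside⇒≢ B x∈B v∉B
      pointwise : ∀ y → C B x y ≡ C B′ x y
      pointwise y with y ≟ x
      ... | yes refl = trans (fundamental-self 𝓑 B y) (sym (fundamental-self 𝓑 B′ y))
      ... | no y≢x
        rewrite fundamental-other 𝓑 B x y y≢x | fundamental-other 𝓑 B′ x y y≢x | lookup-B′ x x≢u x≢v | x∈B
        with y ≟ u | y ≟ v
      ... | yes refl | _
        rewrite u∈B | lookup-τ-a y v B | v∉B | τ-merge x y v B x≢u u≢v x≢v (trans x∈B (sym u∈B)) | x↮v = refl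
      ... | no _ | yes refl rewrite v∉B | x↮v | lookup-τ-b u y B | u∈B = refl
      ... | no y≢u | no y≢v rewrite lookup-B′ y y≢u y≢v with lookup B y in y∈B
      ...   | true = refl
      ...   | false = exchange-stable-inside x y x∈B y∈B x≢u y≢u y≢v x↮v

    fundamental-stable-outside : ∀ x → lookup B x ≡ false → x ≢ v → 𝓑 (τ u x B) ≡ false → ∀ y → C B x y ≡ C B′ x y
    fundamental-stable-outside x x∉B x≢v u↮x = pointwise
      where
      x≢u = inside-outside⇒≢ B u∈B x∉B ∘ sym
      x↮v′ : 𝓑 (τ x v B′) ≡ false
      x↮v′ = trans (cong (λ S → 𝓑 (τ x v S)) (τ-sym u v B))
               (trans (cong 𝓑 (τ-merge x v u B x≢v (u≢v ∘ sym) x≢u (trans x∉B (sym v∉B))))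
                 (trans (cong 𝓑 (τ-sym x u B)) u↮x))
      pointwise : ∀ y → C B x y ≡ C B′ x y
      pointwise y with y ≟ x
      ... | yes refl = trans (fundamental-self 𝓑 B y) (sym (fundamental-self 𝓑 B′ y))
      ... | no y≢x
        rewrite fundamental-other 𝓑 B x y y≢x | fundamental-other 𝓑 B′ x y y≢x | lookup-B′ x x≢u x≢v | x∉B
        with y ≟ u | y ≟ v
      ... | yes refl | _ rewrite u∈B | lookup-τ-a y v B | v∉B | τ-sym x y B | u↮x = refl
      ... | no _ | yes refl rewrite v∉B | lookup-τ-b u y B | u∈B | x↮v′ = refl
      ... | no y≢u | no y≢v rewrite lookup-B′ y y≢u y≢v with lookup B y in y∈B
      ...   | false = refl
      ...   | true = exchange-stable-outside x y x∉B y∈B x≢v y≢u y≢v u↮x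

    exchange-back-inside : ∀ x y → lookup B x ≡ true → lookup B y ≡ false → x ≢ u → y ≢ u → y ≢ v →
      𝓑 (τ x y B′) ≡ true → C B x y ≡ true ⊎ C B u y ≡ true
    exchange-back-inside x y x∈B y∉B x≢u y≢u y≢v h
      with exchange-τ (τ x y B′) B v h basis
             (trans (lookup-τ-other x y B′ v (x≢v ∘ sym) (y≢v ∘ sym)) (trans (lookup-τ-b u v B) u∈B)) v∉B
      where x≢v = inside-outside⇒≢ B x∈B v∉B
    ... | z , z∈ , z∉ , h′ with z ≟ x | z ≟ u | z ≟ y | z ≟ v
    ... | yes refl | _ | _ | _ =
      inj₂ (fundamental-intro 𝓑 B u y (true-xor-false u∈B y∉B)
              (trans (cong 𝓑 (sym (τ-collapse u v z y B x≢u (inside-outside⇒≢ B x∈B v∉B) (inside-outside⇒≢ B x∈B y∉B)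
                                      u≢v y≢u y≢v (trans u∈B (sym x∈B)) (trans y∉B (sym v∉B))))) h′))
    ... | no _ | yes refl | _ | _ =
      inj₁ (fundamental-intro 𝓑 B x y (true-xor-false x∈B y∉B)
              (trans (cong 𝓑 (sym (τ-cancel-commuting z v x y B x≢u (inside-outside⇒≢ B x∈B v∉B) y≢u y≢v))) h′))
    ... | no _ | no _ | yes refl | _ = contradictionᵇ z∈ y∉B
    ... | no _ | no _ | no _ | yes refl = contradictionᵇ z∈ v∉B
    ... | no z≢x | no z≢u | no z≢y | no z≢v =
      contradictionᵇ z∈ (trans (sym (trans (lookup-τ-other x y B′ z z≢x z≢y) (lookup-B′ z z≢u z≢v))) z∉)

    exchange-back-outside : ∀ x y → lookup B x ≡ false → lookup B y ≡ true → x ≢ v → y ≢ u → y ≢ v →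
      𝓑 (τ x y B′) ≡ true → C B x y ≡ true ⊎ C B v y ≡ true
    exchange-back-outside x y x∉B y∈B x≢v y≢u y≢v h
      with exchange-τ B (τ x y B′) y basis h y∈B
             (trans (lookup-τ-b x y B′) (trans (lookup-B′ x x≢u x≢v) x∉B))
      where x≢u = inside-outside⇒≢ B u∈B x∉B ∘ sym
    ... | z , z∈ , z∉ , h′ with z ≟ v | z ≟ x | z ≟ u | z ≟ y
    ... | yes refl | _ | _ | _ = inj₂ (fundamental-intro 𝓑 B z y (false-xor-true v∉B y∈B) (trans (cong 𝓑 (τ-sym z y B)) h′))
    ... | no _ | yes refl | _ | _ = inj₁ (fundamental-intro 𝓑 B z y (false-xor-true x∉B y∈B) (trans (cong 𝓑 (τ-sym z y B)) h′))
    ... | no _ | no _ | yes refl | _ = contradictionᵇ u∈B z∉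
    ... | no _ | no _ | no _ | yes refl = contradictionᵇ y∈B z∉
    ... | no z≢v | no z≢x | no z≢u | no z≢y =
      contradictionᵇ (trans (sym (trans (lookup-τ-other x y B′ z z≢x z≢y) (lookup-B′ z z≢u z≢v))) z∈) z∉

    fundamental-exchanged-inside : ∀ x → lookup B x ≡ true → x ≢ u → 𝓑 (τ x v B) ≡ true →
      ∀ y → C B′ x y ≡ true → C B x y ≡ true ⊎ C B u y ≡ true
    fundamental-exchanged-inside x x∈B x≢u x↔v y h with y ≟ x | y ≟ u | y ≟ v
    ... | yes refl | _ | _ = inj₁ (fundamental-self 𝓑 B y)
    ... | no _ | yes refl | _ = inj₂ (fundamental-self 𝓑 B y)
    ... | no _ | no _ | yes refl = inj₁ (fundamental-intro 𝓑 B x y (true-xor-false x∈B v∉B) x↔v)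
    ... | no y≢x | no y≢u | no y≢v with sides′ , h′ ← fundamental-elim 𝓑 B′ x y y≢x h =
      exchange-back-inside x y x∈B y∉B x≢u y≢u y≢v h′
      where
      x∈B′ = trans (lookup-B′ x x≢u (inside-outside⇒≢ B x∈B v∉B)) x∈B
      y∉B = trans (sym (lookup-B′ y y≢u y≢v)) (trans (xor≡true⇒≡not sides′) (cong not x∈B′))

    fundamental-exchanged-outside : ∀ x → lookup B x ≡ false → x ≢ v → 𝓑 (τ u x B) ≡ true →
      ∀ y → C B′ x y ≡ true → C B x y ≡ true ⊎ C B v y ≡ true
    fundamental-exchanged-outside x x∉B x≢v u↔x y h with y ≟ x | y ≟ v | y ≟ u
    ... | yes refl | _ | _ = inj₁ (fundamental-self 𝓑 B y)
    ... | no _ | yes refl | _ = inj₂ (fundamental-self 𝓑 B y)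
    ... | no _ | no _ | yes refl = inj₁ (fundamental-intro 𝓑 B x y (false-xor-true x∉B u∈B) (trans (cong 𝓑 (τ-sym x y B)) u↔x))
    ... | no y≢x | no y≢v | no y≢u with sides′ , h′ ← fundamental-elim 𝓑 B′ x y y≢x h =
      exchange-back-outside x y x∉B y∈B x≢v y≢u y≢v h′
      where
      x∉B′ = trans (lookup-B′ x (inside-outside⇒≢ B u∈B x∉B ∘ sym) x≢v) x∉B
      y∈B = trans (sym (lookup-B′ y y≢u y≢v)) (trans (xor≡true⇒≡not sides′) (cong not x∉B′))

    -- Either the fundamental set of x does not change, or its new members come from that of u (x ∈ B)
    -- resp. v (x ∉ B), which then has no element in p; so x, being first in p, stays first.
    active-after-exchange : ∀ p q x → x ≢ u → x ≢ v →
      (first (C B u) p ≡ nothing ⊎ first (C B v) p ≡ nothing) →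
      ((C B x u ≡ true ⊎ C B x v ≡ true) → first (C B x) p ≡ just x) →
      Active 𝓑 (p ++ q) B x → Active 𝓑 (p ++ q) B′ x
    active-after-exchange p q x x≢u x≢v quiet in-prefix active with true-or-false (lookup B x)
    ... | inj₁ x∈B with true-or-false (𝓑 (τ x v B))
    ...   | inj₂ x↮v = trans (sym (first-cong (fundamental-stable-inside x x∈B x≢u x↮v) (p ++ q))) active
    ...   | inj₁ x↔v =
      first-++-just (C B′ x) p q (first-⊆ (C B x) (C B′ x) p within-p prefix-active (fundamental-self 𝓑 B′ x))
      where
      prefix-active = in-prefix (inj₂ (fundamental-intro 𝓑 B x v (true-xor-false x∈B v∉B) x↔v))
      u-quiet : first (C B u) p ≡ nothing
      u-quiet = [ id , (λ v-quiet → contradictionᵇ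
                    (fundamental-intro 𝓑 B v x (false-xor-true v∉B x∈B) (trans (cong 𝓑 (τ-sym v x B)) x↔v))
                    (first-nothing⇒false (C B v) p v-quiet (first-∈ (C B x) p prefix-active))) ]′ quiet
      within-p : ∀ y → y ∈ p → C B′ x y ≡ true → C B x y ≡ true
      within-p y y∈p h = [ id , (λ C-u-y → contradictionᵇ C-u-y (first-nothing⇒false (C B u) p u-quiet y∈p)) ]′
                           (fundamental-exchanged-inside x x∈B x≢u x↔v y h)
    active-after-exchange p q x x≢u x≢v quiet in-prefix active | inj₂ x∉B with true-or-false (𝓑 (τ u x B))
    ...   | inj₂ u↮x = trans (sym (first-cong (fundamental-stable-outside x x∉B x≢v u↮x) (p ++ q))) active
    ...   | inj₁ u↔x =
      first-++-just (C B′ x) p q (first-⊆ (C B x) (C B′ x) p within-p prefix-active (fundamental-self 𝓑 B′ x))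
      where
      prefix-active =
        in-prefix (inj₁ (fundamental-intro 𝓑 B x u (false-xor-true x∉B u∈B) (trans (cong 𝓑 (τ-sym x u B)) u↔x)))
      v-quiet : first (C B v) p ≡ nothing
      v-quiet = [ (λ u-quiet → contradictionᵇ
                    (fundamental-intro 𝓑 B u x (true-xor-false u∈B x∉B) u↔x)
                    (first-nothing⇒false (C B u) p u-quiet (first-∈ (C B x) p prefix-active))) , id ]′ quiet
      within-p : ∀ y → y ∈ p → C B′ x y ≡ true → C B x y ≡ true
      within-p y y∈p h = [ id , (λ C-v-y → contradictionᵇ C-v-y (first-nothing⇒false (C B v) p v-quiet y∈p)) ]′
                           (fundamental-exchanged-outside x x∉B x≢v u↔x y h)

-- Counting φ-preimages through activity

-- hits, iω and Tω for the order in which the elements occur in L.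
hitsᴸ : Family n → List (Fin n) → Subset n → Subset n → Bool
hitsᴸ 𝓒 L B D with first (inU 𝓒 D) L
... | nothing = false
... | just x  = isYes (≡-dec Bool._≟_ (D +ₛ x) B)

iᴸ : Family n → List (Fin n) → Subset n → ℕ
iᴸ {n} 𝓒 L B = count (hitsᴸ 𝓒 L B) (allSubsets n)

Tᴸ : Family n → Family n → (Subset n → Subset n) → List (Fin n) → ℕ → ℕ → ℕ
Tᴸ {n} 𝓑 𝓑* f L a b = count (λ B → 𝓑 B ∧ (iᴸ 𝓑 L B ≡ᵇ a) ∧ (iᴸ 𝓑* L (f B) ≡ᵇ b)) (allSubsets n)

-- F ∈ 𝓒 and B ∈ 𝓑 have the same exchange graph.
record Mirror (𝓑 𝓒 : Family n) (F B : Subset n) : Set where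
  field
    basis     : 𝓒 F ≡ true
    sides     : ∀ x z → x ≢ z → (lookup F x xor lookup F z) ≡ (lookup B x xor lookup B z)
    exchanges : ∀ x z → x ≢ z → 𝓒 (τ x z F) ≡ 𝓑 (τ x z B)

mirror-self : {𝓑 : Family n} {B : Subset n} → 𝓑 B ≡ true → Mirror 𝓑 𝓑 B B
mirror-self basis = record { basis = basis ; sides = λ _ _ _ → refl ; exchanges = λ _ _ _ → refl }

mirror-linked : {𝓑 𝓑* : Family n} {f : Subset n → Subset n} → IsLinking 𝓑 𝓑* f →
  {B : Subset n} → 𝓑 B ≡ true → Mirror 𝓑 𝓑* (f B) B
mirror-linked {𝓑 = 𝓑} {𝓑*} {f} (maps , injective , _ , linked) {B} basis = record
  { basis     = T⇒≡true (maps B B∈)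
  ; sides     = λ x z x≢z → xor-cong (F-same⇒B-same x z x≢z) (B-same⇒F-same x z x≢z)
  ; exchanges = λ x z x≢z → ≡true⇔⇒≡ (λ h → T⇒≡true (proj₁ (proj₂ (linked B B∈ x z x≢z) (≡true⇒T h))))
                                       (λ h → T⇒≡true (proj₁ (proj₁ (linked B B∈ x z x≢z) (≡true⇒T h))))
  }
  where
  B∈ = ≡true⇒T basis
  F-same⇒B-same : ∀ x z → x ≢ z → lookup (f B) x ≡ lookup (f B) z → lookup B x ≡ lookup B z
  F-same⇒B-same x z x≢z same
    with τB∈ , τF≡fτB ← proj₂ (linked B B∈ x z x≢z)
                          (subst (λ S → S ∈𝓑 𝓑*) (sym (τ-same-side x z (f B) same)) (maps B B∈))
    = trans (sym (lookup-τ-b x z B))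
        (cong (λ S → lookup S z) (injective (τ x z B) B τB∈ B∈ (trans (sym τF≡fτB) (τ-same-side x z (f B) same))))
  B-same⇒F-same : ∀ x z → x ≢ z → lookup B x ≡ lookup B z → lookup (f B) x ≡ lookup (f B) z
  B-same⇒F-same x z x≢z same
    with _ , τF≡fτB ← proj₁ (linked B B∈ x z x≢z) (subst (λ S → S ∈𝓑 𝓑) (sym (τ-same-side x z B same)) B∈)
    = trans (sym (lookup-τ-b x z (f B))) (cong (λ S → lookup S z) (trans τF≡fτB (cong f (τ-same-side x z B same))))

module _ {𝓑 𝓒 : Family n} {F B : Subset n} (M : Mirror 𝓑 𝓒 F B) where

  open Mirror M

  inU-minus≡fundamental : ∀ x → lookup F x ≡ true → ∀ z → inU 𝓒 (F - x) z ≡ fundamental 𝓑 B x z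
  inU-minus≡fundamental x x∈F z with z ≟ x
  ... | yes refl
    rewrite isYes-∈? z (F - z) | lookup-minus-self F z | minus-plus F z x∈F | basis = sym (fundamental-self 𝓑 B z)
  ... | no z≢x
    rewrite isYes-∈? z (F - x) | lookup-minus-other F x z z≢x | fundamental-other 𝓑 B x z z≢x
          | sym (sides x z (z≢x ∘ sym)) | x∈F
    with lookup F z in z∈F
  ... | true  = refl
  ... | false rewrite exchange≡τ F x z x∈F z∈F | exchanges x z (z≢x ∘ sym) = refl

  hits⇒active : ∀ L D → hitsᴸ 𝓒 L F D ≡ true →
    Σ (Fin n) λ y → lookup F y ≡ true × D ≡ F - y × Active 𝓑 L B y
  hits⇒active L D h with first (inU 𝓒 D) L in eq
  ... | just y with ≡-dec Bool._≟_ (D +ₛ y) F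
  ...   | yes D+y≡F =
    y , y∈F , D≡F-y ,
    trans (sym (first-cong (inU-minus≡fundamental y y∈F) L)) (subst (λ S → first (inU 𝓒 S) L ≡ just y) D≡F-y eq)
    where
    y∈F : lookup F y ≡ true
    y∈F = trans (cong (λ S → lookup S y) (sym D+y≡F)) (lookup-plus-self D y)
    y∉D : lookup D y ≡ false
    y∉D with isYes (y ∈? D) in y∈?D | first-satisfies (inU 𝓒 D) L eq
    ... | false | _ = trans (sym (isYes-∈? y D)) y∈?D
    D≡F-y : D ≡ F - y
    D≡F-y = plus⇒minus D F y y∉D D+y≡F

  active⇒hits : ∀ L y → lookup F y ≡ true → Active 𝓑 L B y → hitsᴸ 𝓒 L F (F - y) ≡ true
  active⇒hits L y y∈F active with first (inU 𝓒 (F - y)) L | first-cong (inU-minus≡fundamental y y∈F) L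
  ... | _ | refl rewrite active | minus-plus F y y∈F with ≡-dec Bool._≟_ F F
  ...   | yes _ = refl
  ...   | no F≢F = ⊥-elim (F≢F refl)

  iᴸ-cong : ∀ L₁ L₂ → (∀ y → Active 𝓑 L₁ B y → Active 𝓑 L₂ B y) →
    (∀ y → Active 𝓑 L₂ B y → Active 𝓑 L₁ B y) →
    iᴸ 𝓒 L₁ F ≡ iᴸ 𝓒 L₂ F
  iᴸ-cong L₁ L₂ to from = count-cong (λ D → ≡true⇔⇒≡ (transfer L₁ L₂ to D) (transfer L₂ L₁ from D)) (allSubsets n)
    where
    transfer : ∀ L L′ → (∀ y → Active 𝓑 L B y → Active 𝓑 L′ B y) →
      ∀ D → hitsᴸ 𝓒 L F D ≡ true → hitsᴸ 𝓒 L′ F D ≡ true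
    transfer L L′ active D h with y , y∈F , refl , y-active ← hits⇒active L D h =
      active⇒hits L′ y y∈F (active y y-active)

module _ {𝓑 𝓒 : Family n} {F B : Subset n} (a b : Fin n)
         (M : Mirror 𝓑 𝓒 F B) (M′ : Mirror 𝓑 𝓒 (τ a b F) (τ a b B)) where

  iᴸ-τ : ∀ L₁ L₂ → (∀ y → Active 𝓑 L₁ B y → Active 𝓑 L₂ (τ a b B) (τᵉ a b y)) →
    (∀ y → Active 𝓑 L₂ (τ a b B) y → Active 𝓑 L₁ B (τᵉ a b y)) →
    iᴸ 𝓒 L₁ F ≡ iᴸ 𝓒 L₂ (τ a b F)
  iᴸ-τ L₁ L₂ to from =
    trans (count-cong (λ D → ≡true⇔⇒≡ (forward D) (backward D)) (allSubsets n))
          (sym (count-allSubsets-involution (τ a b) (τ-involutive a b) (hitsᴸ 𝓒 L₂ (τ a b F))))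
    where
    τF∋τy : ∀ y → lookup F y ≡ true → lookup (τ a b F) (τᵉ a b y) ≡ true
    τF∋τy y y∈F = trans (lookup-τ a b F (τᵉ a b y)) (trans (cong (lookup F) (τᵉ-involutive a b y)) y∈F)
    forward : ∀ D → hitsᴸ 𝓒 L₁ F D ≡ true → hitsᴸ 𝓒 L₂ (τ a b F) (τ a b D) ≡ true
    forward D h with y , y∈F , refl , y-active ← hits⇒active M L₁ D h
      rewrite τ-minus a b F y = active⇒hits M′ L₂ (τᵉ a b y) (τF∋τy y y∈F) (to y y-active)
    backward : ∀ D → hitsᴸ 𝓒 L₂ (τ a b F) (τ a b D) ≡ true → hitsᴸ 𝓒 L₁ F D ≡ true
    backward D h with y , y∈τF , τD≡τF-y , y-active ← hits⇒active M′ L₂ (τ a b D) h =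
      subst (λ S → hitsᴸ 𝓒 L₁ F S ≡ true) (sym D≡F-τy)
        (active⇒hits M L₁ (τᵉ a b y) (trans (sym (lookup-τ a b F y)) y∈τF) (from y y-active))
      where
      D≡F-τy : D ≡ F - τᵉ a b y
      D≡F-τy = begin
        D                           ≡⟨ τ-involutive a b D ⟨
        τ a b (τ a b D)             ≡⟨ cong (τ a b) τD≡τF-y ⟩
        τ a b (τ a b F - y)         ≡⟨ τ-minus a b (τ a b F) y ⟩
        τ a b (τ a b F) - τᵉ a b y  ≡⟨ cong (_- τᵉ a b y) (τ-involutive a b F) ⟩
        F - τᵉ a b y                ∎
        where open ≡-Reasoning

-- Swapping two adjacent elements of the order

module AdjacentSwap {n : ℕ} {𝓑 : Family n} (exchange : BasisExchange 𝓑)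
  (p : List (Fin n)) (e g : Fin n) (s : List (Fin n)) (e≢g : e ≢ g) (e∉p : e ∉ p) (g∉p : g ∉ p) where

  open Matroid exchange

  private
    C = fundamental 𝓑

  L₁ L₂ : List (Fin n)
  L₁ = p ++ e ∷ g ∷ s
  L₂ = p ++ g ∷ e ∷ s

  Quiet : Subset n → Set
  Quiet B = first (C B e) p ≡ nothing ⊎ first (C B g) p ≡ nothing

  Flippable : Subset n → Set
  Flippable B = 𝓑 B ≡ true × 𝓑 (τ e g B) ≡ true × (lookup B e xor lookup B g) ≡ true × Quiet B

  flippable? : ∀ B → Dec (Flippable B)
  flippable? B = 𝓑 B Bool.≟ true ×-dec 𝓑 (τ e g B) Bool.≟ true ×-dec (lookup B e xor lookup B g) Bool.≟ true
                 ×-dec (Maybe.≡-dec _≟_ (first (C B e) p) nothing ⊎-dec Maybe.≡-dec _≟_ (first (C B g) p) nothing)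

  active-unflippable-to : ∀ B → 𝓑 B ≡ true → ¬ Flippable B → ∀ y → Active 𝓑 L₁ B y → Active 𝓑 L₂ B y
  active-unflippable-to B basis ¬F y active with y ≟ e | y ≟ g
  ... | yes refl | _ = first-skip (C B y) p y g s g-passive (fundamental-self 𝓑 B y) e-quiet
    where
    e-quiet = first-∉-prefix (C B y) p (y ∷ g ∷ s) e∉p active
    g-passive : C B y g ≡ false
    g-passive with true-or-false (C B y g)
    ... | inj₂ passive = passive
    ... | inj₁ C-e-g with sides , basis′ ← fundamental-elim 𝓑 B y g (e≢g ∘ sym) C-e-g =
      ⊥-elim (¬F (basis , basis′ , sides , inj₁ e-quiet))
  ... | no _ | yes refl =
    first-after-prefix (C B y) p y (e ∷ s) (fundamental-self 𝓑 B y) (first-∉-prefix (C B y) p (e ∷ y ∷ s) g∉p active)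
  ... | no y≢e | no y≢g = first-swap-other (C B y) p e g s y≢e y≢g active

  active-unflippable-from : ∀ B → 𝓑 B ≡ true → ¬ Flippable B → ∀ y → Active 𝓑 L₂ B y → Active 𝓑 L₁ B y
  active-unflippable-from B basis ¬F y active with y ≟ e | y ≟ g
  ... | yes refl | _ =
    first-after-prefix (C B y) p y (g ∷ s) (fundamental-self 𝓑 B y) (first-∉-prefix (C B y) p (g ∷ y ∷ s) e∉p active)
  ... | no _ | yes refl = first-skip (C B y) p y e s e-passive (fundamental-self 𝓑 B y) g-quiet
    where
    g-quiet = first-∉-prefix (C B y) p (y ∷ e ∷ s) g∉p active
    e-passive : C B y e ≡ false
    e-passive with true-or-false (C B y e)
    ... | inj₂ passive = passive
    ... | inj₁ C-g-e with sides , basis′ ← fundamental-elim 𝓑 B y e e≢g C-g-e =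
      ⊥-elim (¬F (basis , trans (cong 𝓑 (τ-sym e y B)) basis′ ,
                  trans (xor-comm (lookup B e) (lookup B y)) sides , inj₂ g-quiet))
  ... | no y≢e | no y≢g = first-swap-other (C B y) p g e s y≢g y≢e active

  active-flippable-other : ∀ B → Flippable B → ∀ x → x ≢ e → x ≢ g → Active 𝓑 L₁ B x → Active 𝓑 L₁ (τ e g B) x
  active-flippable-other B (basis , basis′ , sides , quiet) x x≢e x≢g active with true-or-false (lookup B e)
  ... | inj₁ e∈B =
    active-after-exchange E p (e ∷ g ∷ s) x x≢e x≢g quiet
      (λ adjacent → first-in-prefix (C B x) p e g s adjacent x≢e x≢g active) active
    where
    E : IsExchange 𝓑 B e g
    E = record { basis = basis ; basis′ = basis′ ; u∈B = e∈B ; v∉B = trans (xor≡true⇒≡not sides) (cong not e∈B) }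
  ... | inj₂ e∉B = subst (λ S → Active 𝓑 L₁ S x) (τ-sym g e B)
    (active-after-exchange E p (e ∷ g ∷ s) x x≢g x≢e ([ inj₂ , inj₁ ]′ quiet)
      (λ adjacent → first-in-prefix (C B x) p e g s ([ inj₂ , inj₁ ]′ adjacent) x≢e x≢g active) active)
    where
    E : IsExchange 𝓑 B g e
    E = record { basis = basis ; basis′ = trans (cong 𝓑 (τ-sym g e B)) basis′
               ; u∈B = trans (xor≡true⇒≡not sides) (cong not e∉B) ; v∉B = e∉B }

  module _ {B : Subset n} (flippable : Flippable B) where

    private
      basis  = proj₁ flippable
      basis′ = proj₁ (proj₂ flippable)
      sides  = proj₁ (proj₂ (proj₂ flippable))
      quiet  = proj₂ (proj₂ (proj₂ flippable))
      B′ = τ e g B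
      sides′ : (lookup B′ e xor lookup B′ g) ≡ true
      sides′ = trans (cong₂ _xor_ (lookup-τ-a e g B) (lookup-τ-b e g B)) (trans (xor-comm (lookup B g) (lookup B e)) sides)
      basis″ : 𝓑 (τ e g B′) ≡ true
      basis″ = trans (cong 𝓑 (τ-involutive e g B)) basis
      C-B′-g : ∀ z → C B′ g z ≡ C B e z
      C-B′-g = fundamental-τ 𝓑 B e g basis basis′ sides
      C-B′-e : ∀ z → C B′ e z ≡ C B g z
      C-B′-e z = trans (cong (λ S → C S e z) (τ-sym e g B))
                   (fundamental-τ 𝓑 B g e basis (trans (cong 𝓑 (τ-sym g e B)) basis′)
                      (trans (xor-comm (lookup B g) (lookup B e)) sides) z)

    flippable-τ : Flippable B′
    flippable-τ = basis′ , basis″ , sides′ ,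
      [ (λ e-quiet → inj₂ (trans (first-cong C-B′-g p) e-quiet))
      , (λ g-quiet → inj₁ (trans (first-cong C-B′-e p) g-quiet)) ]′ quiet

    active-flippable-to : ∀ y → Active 𝓑 L₁ B y → Active 𝓑 L₂ B′ (τᵉ e g y)
    active-flippable-to y active = by-cases (y ≟ e) (y ≟ g)
      where
      by-cases : Dec (y ≡ e) → Dec (y ≡ g) → Active 𝓑 L₂ B′ (τᵉ e g y)
      by-cases (yes refl) _ rewrite τᵉ-a e g =
        first-after-prefix (C B′ g) p g (e ∷ s) (fundamental-self 𝓑 B′ g)
          (trans (first-cong C-B′-g p) (first-∉-prefix (C B e) p (e ∷ g ∷ s) e∉p active))
      by-cases (no _) (yes refl) =
        ⊥-elim (first-blocked (C B g) p e g s g∉p e≢g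
                  (fundamental-intro 𝓑 B g e (trans (xor-comm (lookup B g) (lookup B e)) sides) (trans (cong 𝓑 (τ-sym g e B)) basis′))
                  active)
      by-cases (no y≢e) (no y≢g) rewrite τᵉ-other e g y y≢e y≢g =
        first-swap-other (C B′ y) p e g s y≢e y≢g (active-flippable-other B flippable y y≢e y≢g active)

    active-flippable-from : ∀ y → Active 𝓑 L₂ B′ y → Active 𝓑 L₁ B (τᵉ e g y)
    active-flippable-from y active = by-cases (y ≟ e) (y ≟ g)
      where
      by-cases : Dec (y ≡ e) → Dec (y ≡ g) → Active 𝓑 L₁ B (τᵉ e g y)
      by-cases (yes refl) _ =
        ⊥-elim (first-blocked (C B′ e) p g e s e∉p (e≢g ∘ sym) (fundamental-intro 𝓑 B′ e g sides′ basis″) active)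
      by-cases (no _) (yes refl) rewrite τᵉ-b e g =
        first-after-prefix (C B e) p e (g ∷ s) (fundamental-self 𝓑 B e)
          (trans (sym (first-cong C-B′-g p)) (first-∉-prefix (C B′ g) p (g ∷ e ∷ s) g∉p active))
      by-cases (no y≢e) (no y≢g) rewrite τᵉ-other e g y y≢e y≢g =
        subst (λ S → Active 𝓑 L₁ S y) (τ-involutive e g B)
          (active-flippable-other B′ flippable-τ y y≢e y≢g (first-swap-other (C B′ y) p g e s y≢g y≢e active))

  flip : Subset n → Subset n
  flip B = if does (flippable? B) then τ e g B else B

  flip-flippable : ∀ {B} → Flippable B → flip B ≡ τ e g B
  flip-flippable {B} F rewrite dec-true (flippable? B) F = refl

  flip-unflippable : ∀ {B} → ¬ Flippable B → flip B ≡ B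
  flip-unflippable {B} ¬F rewrite dec-false (flippable? B) ¬F = refl

  flip-involutive : ∀ B → flip (flip B) ≡ B
  flip-involutive B with flippable? B
  ... | yes F  = trans (cong flip (flip-flippable F)) (trans (flip-flippable (flippable-τ F)) (τ-involutive e g B))
  ... | no ¬F = trans (cong flip (flip-unflippable ¬F)) (flip-unflippable ¬F)

  module _ {𝓑* : Family n} {f : Subset n → Subset n} (linking : IsLinking 𝓑 𝓑* f) (a b : ℕ) where

    weight : List (Fin n) → Subset n → Bool
    weight L B = 𝓑 B ∧ (iᴸ 𝓑 L B ≡ᵇ a) ∧ (iᴸ 𝓑* L (f B) ≡ᵇ b)

    weight-cong : ∀ {L L′ B B′} → 𝓑 B ≡ 𝓑 B′ →
      iᴸ 𝓑 L B ≡ iᴸ 𝓑 L′ B′ → iᴸ 𝓑* L (f B) ≡ iᴸ 𝓑* L′ (f B′) →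
      weight L B ≡ weight L′ B′
    weight-cong basis≡ i≡ i*≡ rewrite basis≡ | i≡ | i*≡ = refl

    weight-flip : ∀ B → weight L₁ B ≡ weight L₂ (flip B)
    weight-flip B with flippable? B
    ... | yes F@(basis , basis′ , _) rewrite flip-flippable F =
      weight-cong {L₁} {L₂} {B} {τ e g B} (trans basis (sym basis′))
        (iᴸ-τ e g (mirror-self basis) (mirror-self basis′) L₁ L₂ (active-flippable-to F) (active-flippable-from F))
        (trans (iᴸ-τ e g (mirror-linked linking basis)
                         (subst (λ S → Mirror 𝓑 𝓑* S (τ e g B)) (sym fτ≡τf) (mirror-linked linking basis′))
                  L₁ L₂ (active-flippable-to F) (active-flippable-from F))
               (cong (iᴸ 𝓑* L₂) fτ≡τf))
      where
      fτ≡τf : τ e g (f B) ≡ f (τ e g B)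
      fτ≡τf = proj₂ (proj₁ (proj₂ (proj₂ (proj₂ linking)) B (≡true⇒T basis) e g e≢g) (≡true⇒T basis′))
    ... | no ¬F rewrite flip-unflippable ¬F with true-or-false (𝓑 B)
    ...   | inj₁ basis =
      weight-cong {L₁} {L₂} {B} {B} refl
        (iᴸ-cong (mirror-self basis) L₁ L₂ (active-unflippable-to B basis ¬F) (active-unflippable-from B basis ¬F))
        (iᴸ-cong (mirror-linked linking basis) L₁ L₂ (active-unflippable-to B basis ¬F) (active-unflippable-from B basis ¬F))
    ...   | inj₂ non-basis rewrite non-basis = refl

    Tᴸ-swap : Tᴸ 𝓑 𝓑* f L₁ a b ≡ Tᴸ 𝓑 𝓑* f L₂ a b
    Tᴸ-swap = trans (count-cong weight-flip (allSubsets n))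
                    (sym (count-allSubsets-involution flip flip-involutive (weight L₂)))

-- Orders as enumerations

enumeration : Permutation′ n → List (Fin n)
enumeration {n} ω = map (ω ⟨$⟩ˡ_) (allFin n)

enumeration-unique : (ω : Permutation′ n) → Unique (enumeration ω)
enumeration-unique {n} ω =
  Unique.map⁺ (λ e → trans (sym (inverseʳ ω)) (trans (cong (ω ⟨$⟩ʳ_) e) (inverseʳ ω))) (Unique.allFin⁺ n)

enumeration-complete : (ω : Permutation′ n) → ∀ x → x ∈ enumeration ω
enumeration-complete {n} ω x = subst (_∈ enumeration ω) (inverseˡ ω) (∈-map⁺ (ω ⟨$⟩ˡ_) (∈-allFin (ω ⟨$⟩ʳ x)))

first-map : (g : A → A′) (P : A′ → Bool) (l : List A) → first P (map g l) ≡ Maybe.map g (first (P ∘ g) l)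
first-map g P [] = refl
first-map g P (a ∷ l) with P (g a)
... | true  = refl
... | false = first-map g P l

minω≡first : (ω : Permutation′ n) (P : Fin n → Bool) → minω ω P ≡ first P (enumeration ω)
minω≡first {n} ω P rewrite first-map (ω ⟨$⟩ˡ_) P (allFin n) with first (λ k → P (ω ⟨$⟩ˡ k)) (allFin n)
... | nothing = refl
... | just k  = refl

hits≡hitsᴸ : (𝓒 : Family n) (ω : Permutation′ n) (B D : Subset n) → hits 𝓒 ω B D ≡ hitsᴸ 𝓒 (enumeration ω) B D
hits≡hitsᴸ 𝓒 ω B D rewrite sym (minω≡first ω (inU 𝓒 D)) with minω ω (inU 𝓒 D)
... | nothing = refl
... | just x  = refl

Tω≡Tᴸ : (𝓑 𝓑* : Family n) (f : Subset n → Subset n) (ω : Permutation′ n) (a b : ℕ) →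
  Tω 𝓑 𝓑* f ω a b ≡ Tᴸ 𝓑 𝓑* f (enumeration ω) a b
Tω≡Tᴸ {n} 𝓑 𝓑* f ω a b =
  count-cong (λ B → cong₂ (λ i j → 𝓑 B ∧ (i ≡ᵇ a) ∧ (j ≡ᵇ b)) (iω≡iᴸ 𝓑 B) (iω≡iᴸ 𝓑* (f B))) (allSubsets n)
  where
  iω≡iᴸ : (𝓒 : Family n) (B : Subset n) → iω 𝓒 ω B ≡ iᴸ 𝓒 (enumeration ω) B
  iω≡iᴸ 𝓒 B = count-cong (hits≡hitsᴸ 𝓒 ω B) (allSubsets n)

unique-middle : ∀ (p : List A) {a b s} → Unique (p ++ a ∷ b ∷ s) → a ≢ b × a ∉ p × b ∉ p
unique-middle [] ((a≢b ∷ _) ∷ _) = a≢b , (λ ()) , (λ ())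
unique-middle (c ∷ p) {a} {b} {s} (c≢ ∷ u) with a≢b , a∉p , b∉p ← unique-middle p u =
  a≢b , ∉-∷ a (∈-++⁺ʳ p (here refl)) a∉p , ∉-∷ b (∈-++⁺ʳ p (there (here refl))) b∉p
  where
  ∉-∷ : ∀ x → x ∈ p ++ a ∷ b ∷ s → x ∉ p → x ∉ c ∷ p
  ∉-∷ x x∈ x∉p (here refl) = All.lookup c≢ x∈ refl
  ∉-∷ x x∈ x∉p (there x∈p) = x∉p x∈p

module _ {𝓑 𝓑* : Family n} {f : Subset n → Subset n}
         (exchange : BasisExchange 𝓑) (linking : IsLinking 𝓑 𝓑* f) (a b : ℕ) where

  private
    poly : List (Fin n) → ℕ
    poly L = Tᴸ 𝓑 𝓑* f L a b

    reassociate : ∀ p xs l → poly ((p ++ xs) ++ l) ≡ poly (p ++ xs ++ l)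
    reassociate p xs l = cong poly (++-assoc p xs l)

  Tᴸ-↭ : ∀ {l₁ l₂} → l₁ ↭ l₂ → ∀ p → Unique (p ++ l₁) → poly (p ++ l₁) ≡ poly (p ++ l₂)
  Tᴸ-↭ ↭.refl p u = refl
  Tᴸ-↭ (↭.prep x r) p u = begin
    poly (p ++ x ∷ _)       ≡⟨ reassociate p (x ∷ []) _ ⟨
    poly ((p ++ x ∷ []) ++ _) ≡⟨ Tᴸ-↭ r (p ++ x ∷ []) (subst Unique (sym (++-assoc p (x ∷ []) _)) u) ⟩
    poly ((p ++ x ∷ []) ++ _) ≡⟨ reassociate p (x ∷ []) _ ⟩
    poly (p ++ x ∷ _)       ∎
    where open ≡-Reasoning
  Tᴸ-↭ (↭.swap x y r) p u with x≢y , x∉p , y∉p ← unique-middle p u = begin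
    poly (p ++ x ∷ y ∷ _)         ≡⟨ AdjacentSwap.Tᴸ-swap exchange p x y _ x≢y x∉p y∉p linking a b ⟩
    poly (p ++ y ∷ x ∷ _)         ≡⟨ reassociate p (y ∷ x ∷ []) _ ⟨
    poly ((p ++ y ∷ x ∷ []) ++ _) ≡⟨ Tᴸ-↭ r (p ++ y ∷ x ∷ [])
                                       (subst Unique (sym (++-assoc p (y ∷ x ∷ []) _)) (unique-↭ (++⁺ˡ p (↭.swap x y ↭.refl)) u)) ⟩
    poly ((p ++ y ∷ x ∷ []) ++ _) ≡⟨ reassociate p (y ∷ x ∷ []) _ ⟩
    poly (p ++ y ∷ x ∷ _)         ∎
    where open ≡-Reasoning
  Tᴸ-↭ (↭.trans r₁ r₂) p u = trans (Tᴸ-↭ r₁ p u) (Tᴸ-↭ r₂ p (unique-↭ (++⁺ˡ p r₁) u))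

corollary7p2 : (n : ℕ) (𝓑 𝓑* : Family n) (f : Subset n → Subset n) →
    IsMatroid 𝓑 → IsMatroid 𝓑* → IsLinking 𝓑 𝓑* f →
    (ω ω′ : Permutation′ n) → (a b : ℕ) → Tω 𝓑 𝓑* f ω a b ≡ Tω 𝓑 𝓑* f ω′ a b
corollary7p2 n 𝓑 𝓑* f (_ , exchange) _ linking ω ω′ a b = begin
  Tω 𝓑 𝓑* f ω a b                  ≡⟨ Tω≡Tᴸ 𝓑 𝓑* f ω a b ⟩
  Tᴸ 𝓑 𝓑* f (enumeration ω) a b    ≡⟨ Tᴸ-↭ exchange linking a b enumerations-↭ [] (enumeration-unique ω) ⟩
  Tᴸ 𝓑 𝓑* f (enumeration ω′) a b   ≡⟨ Tω≡Tᴸ 𝓑 𝓑* f ω′ a b ⟨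
  Tω 𝓑 𝓑* f ω′ a b                 ∎
  where
  open ≡-Reasoning
  enumerations-↭ : enumeration ω ↭ enumeration ω′
  enumerations-↭ = unique-complete⇒↭ (enumeration-unique ω) (enumeration-unique ω′)
                     (enumeration-complete ω) (enumeration-complete ω′)
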